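{- Let $\Delta, D\ge 3$ be integers and let $p\ge 4$ be a prime. Let $f\in\mathbb{F}_p[x_1,\dots,x_D]$ be chosen uniformly at random among all polynomials of degree at most $\Delta$. Then with probability at least $3/4$, $f$ has at least $p^{D-1}/2$ zeros in $\mathbb{F}_p^D$. -}

module Defs where

open import Data.Nat using (ℕ; zero; suc; _+_; _*_; _^_; _≤_; _≤?_)
open import Data.Nat.Divisibility using (_∣_; _∣?_)
open import Data.Fin using (Fin; toℕ)
open import Data.Nat.ListAction using (sum; product)
open import Data.List using (List; []; _∷_; map; concatMap; filter; length; upTo; allFin)
import Data.List as L
open import Data.Vec using (Vec; []; _∷_)
import Data.Vec as V

vecs : {A : Set} (n : ℕ) → List A → List (Vec A n)
vecs zero    xs = [] ∷ []
vecs (suc n) xs = concatMap (λ x → map (x ∷_) (vecs n xs)) xs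

-- Exponent vectors (monomials x^e) in D variables of total degree ≤ Δ.
monomials : (D Δ : ℕ) → List (Vec ℕ D)
monomials D Δ = filter (λ e → V.sum e ≤? Δ) (vecs D (upTo (suc Δ)))

nMon : (D Δ : ℕ) → ℕ
nMon D Δ = length (monomials D Δ)

-- A polynomial in F_p[x_1..x_D] of degree ≤ Δ: one coefficient in F_p = Fin p
-- for each monomial of degree ≤ Δ.
Poly : (p D Δ : ℕ) → Set
Poly p D Δ = Vec (Fin p) (nMon D Δ)

allPolys : (p D Δ : ℕ) → List (Poly p D Δ)
allPolys p D Δ = vecs (nMon D Δ) (allFin p)

allPoints : (p D : ℕ) → List (Vec (Fin p) D)
allPoints p D = vecs D (allFin p)

monVal : {p D : ℕ} → Vec ℕ D → Vec (Fin p) D → ℕ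
monVal e x = product (V.toList (V.zipWith (λ ei xi → toℕ xi ^ ei) e x))

-- Value of f at x, computed in ℕ (its residue mod p is the value in F_p).
evalℕ : (p D Δ : ℕ) → Poly p D Δ → Vec (Fin p) D → ℕ
evalℕ p D Δ f x =
  sum (map (λ i → toℕ (V.lookup f i) * monVal {p} (L.lookup (monomials D Δ) i) x)
             (allFin (nMon D Δ)))

IsZero : (p D Δ : ℕ) → Poly p D Δ → Vec (Fin p) D → Set
IsZero p D Δ f x = p ∣ evalℕ p D Δ f x

nZeros : (p D Δ : ℕ) → Poly p D Δ → ℕ
nZeros p D Δ f = length (filter (λ x → p ∣? evalℕ p D Δ f x) (allPoints p D))

ManyZeros : (p D Δ : ℕ) → Poly p D Δ → Set
ManyZeros p D Δ f = p ^ (D Data.Nat.∸ 1) ≤ 2 * nZeros p D Δ f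

nGood : (p D Δ : ℕ) → ℕ
nGood p D Δ = length (filter (λ f → p ^ (D Data.Nat.∸ 1) ≤? 2 * nZeros p D Δ f) (allPolys p D Δ))

-- The value of f at a point x is a linear form in the coefficients of f in which the
-- constant coefficient has weight 1, so f(x) = 0 for exactly a 1/p fraction of all f.
-- For x ≠ y pick j with x_j ≠ y_j: once the other coefficients are fixed, at most one
-- choice of the coefficients of 1 and x_j makes f(x) = f(y) = 0, so both vanish for at
-- most a 1/p² fraction of all f.
-- Hence the number of zeros of f has mean M = p^(D-1) and variance at most M, and by
-- Chebyshev's inequality it is below M/2 for at most a 4/M ≤ 1/4 fraction of all f.
module Submission where

open import Defs
open import Data.Empty using (⊥-elim)
open import Data.Fin using (Fin; zero; suc; toℕ; fromℕ<; punchIn; punchOut)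
import Data.Fin.Properties as Fin
import Data.Integer as ℤ
import Data.Integer.Properties as ℤ
open import Data.Integer.Divisibility.Signed using (∣ᵤ⇒∣; ∣⇒∣ᵤ; ∣m∣n⇒∣m-n; divides)
  renaming (_∣_ to _∣ℤ_; _∣?_ to _∣ℤ?_)
open import Data.Integer.DivMod using (_%ℕ_; _/ℕ_; n%ℕd<d; a≡a%ℕn+[a/ℕn]*n)
import Data.Integer.Tactic.RingSolver as ℤ-Ring
open import Data.List using (List; []; _∷_; _++_; map; concatMap; filter; length; allFin)
import Data.List.Properties as List
open import Data.List.Membership.Propositional using (_∈_)
open import Data.List.Membership.Propositional.Properties using (∈-map⁺; ∈-concat⁺′; ∈-filter⁺; ∈-upTo⁺)
open import Data.List.Relation.Unary.Any using (here; index)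
open import Data.List.Relation.Unary.Any.Properties using (lookup-index)
open import Data.Nat using (ℕ; zero; suc; _+_; _*_; _^_; _≤_; _<_; _≤?_; _<?_; _∸_; z≤n; s≤s; NonZero; >-nonZero)
open import Data.Nat.Divisibility using (_∣_; _∣?_; n∣m⇒m%n≡0)
open import Data.Nat.DivMod using (m<n⇒m%n≡m)
open import Data.Nat.ListAction using (sum)
open import Data.Nat.Primality using (Prime; prime⇒nonZero; euclidsLemma)
open import Data.Nat.Properties
open import Algebra.Properties.CommutativeSemigroup +-commutativeSemigroup using (interchange; x∙yz≈y∙xz)
import Data.Nat.Tactic.RingSolver as ℕ-Ring
open import Data.Product using (_,_; ∃; proj₁; proj₂)
open import Data.Sum using (_⊎_; inj₁; inj₂; [_,_]′)
open import Data.Vec using (Vec; []; _∷_; lookup; insertAt; tabulate; replicate)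
import Data.Vec
import Data.Vec.Properties as Vec
open import Function using (_∘_)
open import Relation.Binary.PropositionalEquality
open import Relation.Nullary using (Dec; yes; no; ¬_)
open import Relation.Nullary.Decidable using (_×-dec_)

private variable
  A B : Set
  n p : ℕ

∑ : List A → (A → ℕ) → ℕ
∑ xs g = sum (map g xs)

∑-cong : (xs : List A) {g h : A → ℕ} → (∀ x → g x ≡ h x) → ∑ xs g ≡ ∑ xs h
∑-cong []       g≡h = refl
∑-cong (x ∷ xs) g≡h = cong₂ _+_ (g≡h x) (∑-cong xs g≡h)

∑-mono-≤ : (xs : List A) {g h : A → ℕ} → (∀ x → g x ≤ h x) → ∑ xs g ≤ ∑ xs h
∑-mono-≤ []       g≤h = z≤n
∑-mono-≤ (x ∷ xs) g≤h = +-mono-≤ (g≤h x) (∑-mono-≤ xs g≤h)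

∑-distrib-+ : (xs : List A) (g h : A → ℕ) → ∑ xs (λ x → g x + h x) ≡ ∑ xs g + ∑ xs h
∑-distrib-+ []       g h = refl
∑-distrib-+ (x ∷ xs) g h =
  trans (cong (g x + h x +_) (∑-distrib-+ xs g h)) (interchange (g x) (h x) _ _)

∑-*ˡ : (k : ℕ) (xs : List A) (g : A → ℕ) → ∑ xs (λ x → k * g x) ≡ k * ∑ xs g
∑-*ˡ k []       g = sym (*-zeroʳ k)
∑-*ˡ k (x ∷ xs) g = trans (cong (k * g x +_) (∑-*ˡ k xs g)) (sym (*-distribˡ-+ k (g x) _))

∑-*ʳ : (k : ℕ) (xs : List A) (g : A → ℕ) → ∑ xs (λ x → g x * k) ≡ ∑ xs g * k
∑-*ʳ k xs g = begin
  ∑ xs (λ x → g x * k) ≡⟨ ∑-cong xs (λ x → *-comm (g x) k) ⟩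
  ∑ xs (λ x → k * g x) ≡⟨ ∑-*ˡ k xs g ⟩
  k * ∑ xs g           ≡⟨ *-comm k _ ⟩
  ∑ xs g * k           ∎
  where open ≡-Reasoning

∑-const : (xs : List A) (k : ℕ) → ∑ xs (λ _ → k) ≡ length xs * k
∑-const []       k = refl
∑-const (x ∷ xs) k = cong (k +_) (∑-const xs k)

∑-zero : (xs : List A) → ∑ xs (λ _ → 0) ≡ 0
∑-zero xs = trans (∑-const xs 0) (*-zeroʳ (length xs))

∑-++ : (xs ys : List A) (g : A → ℕ) → ∑ (xs ++ ys) g ≡ ∑ xs g + ∑ ys g
∑-++ []       ys g = refl
∑-++ (x ∷ xs) ys g = trans (cong (g x +_) (∑-++ xs ys g)) (sym (+-assoc (g x) _ _))

∑-comm : (xs : List A) (ys : List B) (g : A → B → ℕ) →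
  ∑ xs (λ x → ∑ ys (g x)) ≡ ∑ ys (λ y → ∑ xs (λ x → g x y))
∑-comm []       ys g = sym (∑-zero ys)
∑-comm (x ∷ xs) ys g =
  trans (cong (∑ ys (g x) +_) (∑-comm xs ys g)) (sym (∑-distrib-+ ys (g x) _))

∑-square : (xs : List A) (g : A → ℕ) → ∑ xs g * ∑ xs g ≡ ∑ xs (λ x → ∑ xs (λ y → g x * g y))
∑-square xs g = trans (sym (∑-*ʳ (∑ xs g) xs g)) (∑-cong xs (λ x → sym (∑-*ˡ (g x) xs g)))

∑-map : (f : A → B) (xs : List A) (g : B → ℕ) → ∑ (map f xs) g ≡ ∑ xs (λ x → g (f x))
∑-map f xs g = cong sum (sym (List.map-∘ xs))

∑-concatMap : (f : A → List B) (xs : List A) (g : B → ℕ) →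
  ∑ (concatMap f xs) g ≡ ∑ xs (λ x → ∑ (f x) g)
∑-concatMap f []       g = refl
∑-concatMap f (x ∷ xs) g = trans (∑-++ (f x) _ g) (cong (∑ (f x) g +_) (∑-concatMap f xs g))

indicator : {P : Set} → Dec P → ℕ
indicator (yes _) = 1
indicator (no _)  = 0

indicator-cong : {P Q : Set} (P? : Dec P) (Q? : Dec Q) → (P → Q) → (Q → P) → indicator P? ≡ indicator Q?
indicator-cong (yes _) (yes _) P→Q Q→P = refl
indicator-cong (yes p) (no ¬q) P→Q Q→P = ⊥-elim (¬q (P→Q p))
indicator-cong (no ¬p) (yes q) P→Q Q→P = ⊥-elim (¬p (Q→P q))
indicator-cong (no _)  (no _)  P→Q Q→P = refl

indicator-idem : {P : Set} (P? : Dec P) → indicator P? * indicator P? ≡ indicator P?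
indicator-idem (yes _) = refl
indicator-idem (no _)  = refl

indicator-yes : {P : Set} (P? : Dec P) → P → indicator P? ≡ 1
indicator-yes (yes _) p = refl
indicator-yes (no ¬p) p = ⊥-elim (¬p p)

indicator-no : {P : Set} (P? : Dec P) → ¬ P → indicator P? ≡ 0
indicator-no (yes p) ¬p = ⊥-elim (¬p p)
indicator-no (no _)  ¬p = refl

indicator-*-mono : {P Q R : Set} (P? : Dec P) (Q? : Dec Q) (R? : Dec R) → (P → Q → R) →
  indicator P? * indicator Q? ≤ indicator P? * indicator R?
indicator-*-mono (yes p) (yes q) R? P→Q→R = ≤-reflexive (cong (1 *_) (sym (indicator-yes R? (P→Q→R p q))))
indicator-*-mono (yes _) (no _)  R? P→Q→R = z≤n
indicator-*-mono (no _)  Q?      R? P→Q→R = z≤n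

length-filter≡∑ : {P : A → Set} (P? : ∀ x → Dec (P x)) (xs : List A) →
  length (filter P? xs) ≡ ∑ xs (indicator ∘ P?)
length-filter≡∑ P? []       = refl
length-filter≡∑ P? (x ∷ xs) with P? x
... | yes _ = cong suc (length-filter≡∑ P? xs)
... | no _  = length-filter≡∑ P? xs

indicator-×-dec : {P Q : Set} (P? : Dec P) (Q? : Dec Q) → indicator (P? ×-dec Q?) ≡ indicator P? * indicator Q?
indicator-×-dec (yes _) (yes _) = refl
indicator-×-dec (yes _) (no _)  = refl
indicator-×-dec (no _)  _       = refl

length≡∑1 : (xs : List A) → length xs ≡ ∑ xs (λ _ → 1)
length≡∑1 xs = sym (trans (∑-const xs 1) (*-identityʳ _))

2mn≤m²+n² : ∀ m n → 2 * (m * n) ≤ m * m + n * n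
2mn≤m²+n² m n = [ ordered , swapped ]′ (≤-total m n)
  where
  ordered : ∀ {a b} → a ≤ b → 2 * (a * b) ≤ a * a + b * b
  ordered {a} {b} a≤b rewrite sym (m+[n∸m]≡n a≤b) =
    ≤-trans (m≤m+n _ _) (≤-reflexive (square-gap a (b ∸ a)))
    where
    square-gap : ∀ a t → 2 * (a * (a + t)) + t * t ≡ a * a + (a + t) * (a + t)
    square-gap = ℕ-Ring.solve-∀
  swapped : n ≤ m → 2 * (m * n) ≤ m * m + n * n
  swapped n≤m = subst₂ _≤_ (cong (2 *_) (*-comm n m)) (+-comm (n * n) (m * m)) (ordered n≤m)

-- M² [N < M/2] ≤ 4 (N − M)², rearranged so that no subtraction occurs.
chebyshev-pointwise : ∀ M N → M * M * indicator (2 * N <? M) + 8 * M * N ≤ 4 * (N * N) + 4 * (M * M)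
chebyshev-pointwise M N with 2 * N <? M
... | yes 2N<M rewrite sym (m+[n∸m]≡n (<⇒≤ 2N<M)) =
  ≤-trans (m≤m+n _ _) (≤-reflexive (gap N (M ∸ 2 * N)))
  where
  gap : ∀ N s → (2 * N + s) * (2 * N + s) * 1 + 8 * (2 * N + s) * N + (4 * N * s + 3 * s * s)
                ≡ 4 * (N * N) + 4 * ((2 * N + s) * (2 * N + s))
  gap = ℕ-Ring.solve-∀
... | no _ = begin
  M * M * 0 + 8 * M * N          ≡⟨ cong (_+ 8 * M * N) (*-zeroʳ (M * M)) ⟩
  8 * M * N                      ≡⟨ regroup M N ⟩
  4 * (2 * (N * M))              ≤⟨ *-monoʳ-≤ 4 (2mn≤m²+n² N M) ⟩
  4 * (N * N + M * M)            ≡⟨ *-distribˡ-+ 4 (N * N) (M * M) ⟩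
  4 * (N * N) + 4 * (M * M)      ∎
  where
  open ≤-Reasoning
  regroup : ∀ M N → 8 * M * N ≡ 4 * (2 * (N * M))
  regroup = ℕ-Ring.solve-∀

module _ (xs : List A) (N : A → ℕ) (M : ℕ) (16≤M : 16 ≤ M)
         (mean : ∑ xs N ≡ length xs * M) (second-moment : ∑ xs (λ a → N a * N a) ≤ length xs * (M * M + M)) where

  private
    L = length xs
    bad : A → ℕ
    bad a = indicator (2 * N a <? M)
    instance
      M≢0 : NonZero M
      M≢0 = >-nonZero (≤-trans (s≤s z≤n) 16≤M)

  chebyshev-tail : 4 * ∑ xs bad ≤ L
  chebyshev-tail = *-cancelˡ-≤ 4 (begin
    4 * (4 * ∑ xs bad)   ≡⟨ *-assoc 4 4 (∑ xs bad) ⟨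
    16 * ∑ xs bad        ≤⟨ *-monoˡ-≤ (∑ xs bad) 16≤M ⟩
    M * ∑ xs bad         ≤⟨ *-cancelˡ-≤ M (subst (_≤ M * (4 * L)) (*-assoc M M _) (+-cancelʳ-≤ _ _ _ weighted)) ⟩
    4 * L                ∎)
    where
    open ≤-Reasoning
    weighted : M * M * ∑ xs bad + 8 * M * (L * M) ≤ M * (4 * L) + 8 * M * (L * M)
    weighted = begin
      M * M * ∑ xs bad + 8 * M * (L * M)
        ≡⟨ cong (λ t → M * M * ∑ xs bad + 8 * M * t) mean ⟨
      M * M * ∑ xs bad + 8 * M * ∑ xs N
        ≡⟨ cong₂ _+_ (∑-*ˡ (M * M) xs bad) (∑-*ˡ (8 * M) xs N) ⟨
      ∑ xs (λ a → M * M * bad a) + ∑ xs (λ a → 8 * M * N a)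
        ≡⟨ ∑-distrib-+ xs _ _ ⟨
      ∑ xs (λ a → M * M * bad a + 8 * M * N a)
        ≤⟨ ∑-mono-≤ xs (λ a → chebyshev-pointwise M (N a)) ⟩
      ∑ xs (λ a → 4 * (N a * N a) + 4 * (M * M))
        ≡⟨ ∑-distrib-+ xs _ _ ⟩
      ∑ xs (λ a → 4 * (N a * N a)) + ∑ xs (λ _ → 4 * (M * M))
        ≡⟨ cong₂ _+_ (∑-*ˡ 4 xs (λ a → N a * N a)) (∑-const xs _) ⟩
      4 * ∑ xs (λ a → N a * N a) + L * (4 * (M * M))
        ≤⟨ +-monoˡ-≤ _ (*-monoʳ-≤ 4 second-moment) ⟩
      4 * (L * (M * M + M)) + L * (4 * (M * M))
        ≡⟨ rearrange L M ⟩
      M * (4 * L) + 8 * M * (L * M) ∎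
      where
      rearrange : ∀ L M → 4 * (L * (M * M + M)) + L * (4 * (M * M)) ≡ M * (4 * L) + 8 * M * (L * M)
      rearrange = ℕ-Ring.solve-∀

  chebyshev-three-quarters : 3 * L ≤ 4 * length (filter (λ a → M ≤? 2 * N a) xs)
  chebyshev-three-quarters = +-cancelʳ-≤ (4 * ∑ xs bad) _ _ (begin
    3 * L + 4 * ∑ xs bad      ≤⟨ +-monoʳ-≤ (3 * L) chebyshev-tail ⟩
    3 * L + L                 ≡⟨ +-comm (3 * L) L ⟩
    4 * L                     ≡⟨ cong (4 *_) good+bad≡L ⟨
    4 * (G + ∑ xs bad)        ≡⟨ *-distribˡ-+ 4 G _ ⟩
    4 * G + 4 * ∑ xs bad      ∎)
    where
    open ≤-Reasoning
    good? = λ a → M ≤? 2 * N a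
    G = length (filter good? xs)
    good+bad≡1 : ∀ a → indicator (good? a) + bad a ≡ 1
    good+bad≡1 a with good? a | 2 * N a <? M
    ... | yes M≤2N | yes 2N<M = ⊥-elim (<⇒≱ 2N<M M≤2N)
    ... | yes _    | no _     = refl
    ... | no _     | yes _    = refl
    ... | no M≰2N  | no 2N≮M  = ⊥-elim (M≰2N (≮⇒≥ 2N≮M))
    good+bad≡L : G + ∑ xs bad ≡ L
    good+bad≡L = begin-equality
      G + ∑ xs bad                                 ≡⟨ cong (_+ ∑ xs bad) (length-filter≡∑ good? xs) ⟩
      ∑ xs (indicator ∘ good?) + ∑ xs bad           ≡⟨ ∑-distrib-+ xs _ _ ⟨
      ∑ xs (λ a → indicator (good? a) + bad a)      ≡⟨ ∑-cong xs good+bad≡1 ⟩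
      ∑ xs (λ _ → 1)                                ≡⟨ length≡∑1 xs ⟨
      L                                            ∎

∑-allFin-suc : (h : Fin (suc n) → ℕ) → ∑ (allFin (suc n)) h ≡ h zero + ∑ (allFin n) (h ∘ suc)
∑-allFin-suc {n} h =
  cong (h zero +_) (trans (cong (λ xs → ∑ xs h) (sym (List.map-tabulate (λ i → i) suc))) (∑-map suc (allFin n) h))

∑-allFin-punchIn : (k : Fin (suc n)) (h : Fin (suc n) → ℕ) →
  ∑ (allFin (suc n)) h ≡ h k + ∑ (allFin n) (h ∘ punchIn k)
∑-allFin-punchIn         zero    h = ∑-allFin-suc h
∑-allFin-punchIn {suc n} (suc k) h = begin
  ∑ (allFin (suc (suc n))) h                                   ≡⟨ ∑-allFin-suc h ⟩
  h zero + ∑ (allFin (suc n)) (h ∘ suc)                         ≡⟨ cong (h zero +_) (∑-allFin-punchIn k (h ∘ suc)) ⟩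
  h zero + (h (suc k) + ∑ (allFin n) (h ∘ suc ∘ punchIn k))     ≡⟨ x∙yz≈y∙xz (h zero) (h (suc k)) _ ⟩
  h (suc k) + (h zero + ∑ (allFin n) (h ∘ suc ∘ punchIn k))     ≡⟨ cong (h (suc k) +_) (sym (∑-allFin-suc (h ∘ punchIn (suc k)))) ⟩
  h (suc k) + ∑ (allFin (suc n)) (h ∘ punchIn (suc k))          ∎
  where open ≡-Reasoning

atMostOne⇒count≤1 : {P : Fin n → Set} (P? : ∀ c → Dec (P c)) →
  (∀ {c c′} → P c → P c′ → c ≡ c′) → ∑ (allFin n) (indicator ∘ P?) ≤ 1
atMostOne⇒count≤1 {zero}  P? unique = z≤n
atMostOne⇒count≤1 {suc n} P? unique rewrite ∑-allFin-suc (indicator ∘ P?) with P? zero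
... | yes P0 = ≤-reflexive (cong suc (trans (∑-cong (allFin n) none-after) (∑-zero (allFin n))))
  where
  none-after : ∀ c → indicator (P? (suc c)) ≡ 0
  none-after c = indicator-no (P? (suc c)) (λ Psc → Fin.0≢1+n (unique P0 Psc))
... | no _   = atMostOne⇒count≤1 (P? ∘ suc) (λ Pc Pc′ → Fin.suc-injective (unique Pc Pc′))

exactlyOne⇒count≡1 : {P : Fin n → Set} (P? : ∀ c → Dec (P c)) (c₀ : Fin n) → P c₀ →
  (∀ {c c′} → P c → P c′ → c ≡ c′) → ∑ (allFin n) (indicator ∘ P?) ≡ 1
exactlyOne⇒count≡1 {suc n} P? c₀ Pc₀ unique =
  ≤-antisym (atMostOne⇒count≤1 P? unique) (subst (1 ≤_) (sym (∑-allFin-punchIn c₀ (indicator ∘ P?))) at-c₀)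
  where
  at-c₀ : 1 ≤ indicator (P? c₀) + ∑ (allFin n) (indicator ∘ P? ∘ punchIn c₀)
  at-c₀ with P? c₀
  ... | yes _ = s≤s z≤n
  ... | no ¬P = ⊥-elim (¬P Pc₀)

∑-vecs-suc : (xs : List A) (g : Vec A (suc n) → ℕ) →
  ∑ (vecs (suc n) xs) g ≡ ∑ xs (λ c → ∑ (vecs n xs) (λ v → g (c ∷ v)))
∑-vecs-suc {n = n} xs g = trans (∑-concatMap _ xs g) (∑-cong xs (λ c → ∑-map (c ∷_) (vecs n xs) g))

∑-vecs-insertAt : (xs : List A) (k : Fin (suc n)) (g : Vec A (suc n) → ℕ) →
  ∑ (vecs (suc n) xs) g ≡ ∑ xs (λ c → ∑ (vecs n xs) (λ v → g (insertAt v k c)))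
∑-vecs-insertAt         xs zero    g = ∑-vecs-suc xs g
∑-vecs-insertAt {n = suc n} xs (suc k) g = begin
  ∑ (vecs (suc (suc n)) xs) g
    ≡⟨ ∑-vecs-suc xs g ⟩
  ∑ xs (λ a → ∑ (vecs (suc n) xs) (λ w → g (a ∷ w)))
    ≡⟨ ∑-cong xs (λ a → ∑-vecs-insertAt xs k (λ w → g (a ∷ w))) ⟩
  ∑ xs (λ a → ∑ xs (λ c → ∑ (vecs n xs) (λ v → g (a ∷ insertAt v k c))))
    ≡⟨ ∑-comm xs xs _ ⟩
  ∑ xs (λ c → ∑ xs (λ a → ∑ (vecs n xs) (λ v → g (a ∷ insertAt v k c))))
    ≡⟨ ∑-cong xs (λ c → sym (∑-vecs-suc xs (λ w → g (insertAt w (suc k) c)))) ⟩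
  ∑ xs (λ c → ∑ (vecs (suc n) xs) (λ w → g (insertAt w (suc k) c)))  ∎
  where open ≡-Reasoning

length-vecs : (n : ℕ) (xs : List A) → length (vecs n xs) ≡ length xs ^ n
length-vecs zero    xs = refl
length-vecs (suc n) xs = begin
  length (vecs (suc n) xs)                      ≡⟨ length≡∑1 (vecs (suc n) xs) ⟩
  ∑ (vecs (suc n) xs) (λ _ → 1)                 ≡⟨ ∑-vecs-suc xs _ ⟩
  ∑ xs (λ _ → ∑ (vecs n xs) (λ _ → 1))          ≡⟨ ∑-const xs _ ⟩
  length xs * ∑ (vecs n xs) (λ _ → 1)           ≡⟨ cong (length xs *_) (sym (length≡∑1 (vecs n xs))) ⟩
  length xs * length (vecs n xs)                ≡⟨ cong (length xs *_) (length-vecs n xs) ⟩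
  length xs * length xs ^ n                     ∎
  where open ≡-Reasoning

infix 4 _≟ᵥ_
_≟ᵥ_ : (x y : Vec (Fin p) n) → Dec (x ≡ y)
_≟ᵥ_ = Vec.≡-dec Fin._≟_

∑-allPoints-≟ : (x : Vec (Fin p) n) → ∑ (allPoints p n) (λ y → indicator (x ≟ᵥ y)) ≡ 1
∑-allPoints-≟          []      = refl
∑-allPoints-≟ {p = p} {n = suc n} (a ∷ x) = begin
  ∑ (allPoints p (suc n)) (λ y → indicator (a ∷ x ≟ᵥ y))
    ≡⟨ ∑-vecs-suc (allFin p) _ ⟩
  ∑ (allFin p) (λ c → ∑ (allPoints p n) (λ v → indicator (a ∷ x ≟ᵥ c ∷ v)))
    ≡⟨ ∑-cong (allFin p) (λ c → ∑-cong (allPoints p n) (λ v → split c v)) ⟩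
  ∑ (allFin p) (λ c → ∑ (allPoints p n) (λ v → indicator (a Fin.≟ c) * indicator (x ≟ᵥ v)))
    ≡⟨ ∑-cong (allFin p) (λ c → ∑-*ˡ (indicator (a Fin.≟ c)) (allPoints p n) _) ⟩
  ∑ (allFin p) (λ c → indicator (a Fin.≟ c) * ∑ (allPoints p n) (λ v → indicator (x ≟ᵥ v)))
    ≡⟨ ∑-cong (allFin p) (λ c → trans (cong (indicator (a Fin.≟ c) *_) (∑-allPoints-≟ x)) (*-identityʳ _)) ⟩
  ∑ (allFin p) (λ c → indicator (a Fin.≟ c))
    ≡⟨ exactlyOne⇒count≡1 (a Fin.≟_) a refl (λ a≡c a≡c′ → trans (sym a≡c) a≡c′) ⟩
  1 ∎
  where
  open ≡-Reasoning
  split : ∀ c v → indicator (a ∷ x ≟ᵥ c ∷ v) ≡ indicator (a Fin.≟ c) * indicator (x ≟ᵥ v)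
  split c v = trans (indicator-cong (a ∷ x ≟ᵥ c ∷ v) (a Fin.≟ c ×-dec x ≟ᵥ v) Vec.∷-injective (λ { (refl , refl) → refl }))
                    (indicator-×-dec (a Fin.≟ c) (x ≟ᵥ v))

length-allPoints : (p n : ℕ) → length (allPoints p n) ≡ p ^ n
length-allPoints p n = trans (length-vecs n (allFin p)) (cong (_^ n) (List.length-tabulate (λ i → i)))

∑-allPoints-1 : (p n : ℕ) → ∑ (allPoints p n) (λ _ → 1) ≡ p ^ n
∑-allPoints-1 p n = trans (sym (length≡∑1 (allPoints p n))) (length-allPoints p n)

≢⇒∃-lookup-≢ : {x y : Vec (Fin p) n} → x ≢ y → ∃ λ j → lookup x j ≢ lookup y j
≢⇒∃-lookup-≢ {n = n} {x} {y} x≢y = Fin.¬∀⟶∃¬ n _ (λ j → lookup x j Fin.≟ lookup y j) (λ x≗y → x≢y (begin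
  x                   ≡⟨ Vec.tabulate∘lookup x ⟨
  tabulate (lookup x) ≡⟨ Vec.tabulate-cong x≗y ⟩
  tabulate (lookup y) ≡⟨ Vec.tabulate∘lookup y ⟩
  y                   ∎))
  where open ≡-Reasoning

linearForm : (Fin n → ℕ) → Vec (Fin p) n → ℕ
linearForm {n = n} w f = ∑ (allFin n) (λ i → toℕ (lookup f i) * w i)

linearForm-insertAt : (w : Fin (suc n) → ℕ) (k : Fin (suc n)) (v : Vec (Fin p) n) (c : Fin p) →
  linearForm w (insertAt v k c) ≡ toℕ c * w k + linearForm (w ∘ punchIn k) v
linearForm-insertAt {n = n} w k v c = begin
  linearForm w (insertAt v k c)
    ≡⟨ ∑-allFin-punchIn k _ ⟩
  toℕ (lookup (insertAt v k c) k) * w k + ∑ (allFin n) (λ i → toℕ (lookup (insertAt v k c) (punchIn k i)) * w (punchIn k i))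
    ≡⟨ cong₂ (λ a b → toℕ a * w k + b) (Vec.insertAt-lookup v k c)
             (∑-cong (allFin n) (λ i → cong (λ a → toℕ a * w (punchIn k i)) (Vec.insertAt-punchIn v k c i))) ⟩
  toℕ c * w k + linearForm (w ∘ punchIn k) v ∎
  where open ≡-Reasoning

linearForm-insertAt-unit : (w : Fin (suc n) → ℕ) (k : Fin (suc n)) → w k ≡ 1 → (v : Vec (Fin p) n) (c : Fin p) →
  linearForm w (insertAt v k c) ≡ toℕ c + linearForm (w ∘ punchIn k) v
linearForm-insertAt-unit w k wk≡1 v c =
  trans (linearForm-insertAt w k v c) (cong (_+ linearForm (w ∘ punchIn k) v) (trans (cong (toℕ c *_) wk≡1) (*-identityʳ (toℕ c))))

-- W x lists the values at x of a family of monomials containing 1 and every coordinate x_j.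
record HasAffineMonomials {p D n : ℕ} (W : Vec (Fin p) D → Fin n → ℕ) : Set where
  field
    one          : Fin n
    coordinate   : Fin D → Fin n
    W-one        : ∀ x → W x one ≡ 1
    W-coordinate : ∀ x j → W x (coordinate j) ≡ toℕ (lookup x j)
    one≢coordinate : ∀ j → one ≢ coordinate j

module _ where
  -- Opened only here: at top level ℤ's prefix +_ makes ℕ sections such as (x +_) ambiguous.
  open import Data.Integer using (+_; _-_; _⊖_)

  infix 4 _≡_mod_ _≡?_mod_
  _≡_mod_ : ℕ → ℕ → ℕ → Set
  a ≡ b mod m = + m ∣ℤ + a - + b

  _≡?_mod_ : (a b m : ℕ) → Dec (a ≡ b mod m)
  a ≡? b mod m = + m ∣ℤ? + a - + b

  ∣∧∣⇒≡-mod : ∀ {m a b} → m ∣ a → m ∣ b → a ≡ b mod m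
  ∣∧∣⇒≡-mod {m} {a} {b} m∣a m∣b = ∣m∣n⇒∣m-n (∣ᵤ⇒∣ {+ m} {+ a} m∣a) (∣ᵤ⇒∣ {+ m} {+ b} m∣b)

  +-cancelˡ-≡-mod : ∀ {m} c a b → c + a ≡ c + b mod m → a ≡ b mod m
  +-cancelˡ-≡-mod {m} c a b = subst (+ m ∣ℤ_) (begin
    + (c + a) - + (c + b)  ≡⟨ ℤ.[+m]-[+n]≡m⊖n (c + a) (c + b) ⟩
    (c + a) ⊖ (c + b)      ≡⟨ ℤ.+-cancelˡ-⊖ c a b ⟩
    a ⊖ b                  ≡⟨ ℤ.[+m]-[+n]≡m⊖n a b ⟨
    + a - + b              ∎)
    where open ≡-Reasoning

  +-cancelʳ-≡-mod : ∀ {m} a b c → a + c ≡ b + c mod m → a ≡ b mod m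
  +-cancelʳ-≡-mod a b c rewrite +-comm a c | +-comm b c = +-cancelˡ-≡-mod c a b

  ≡-mod-difference-factor : ∀ {m α β R R′} a a′ →
    a * α + R ≡ a * β + R′ mod m → a′ * α + R ≡ a′ * β + R′ mod m → + m ∣ℤ (+ a - + a′) ℤ.* (+ α - + β)
  ≡-mod-difference-factor {m} {α} {β} {R} {R′} a a′ eq eq′ = subst (+ m ∣ℤ_) factor (∣m∣n⇒∣m-n eq eq′)
    where
    pos-lin : ∀ x y z → + (x * y + z) ≡ + x ℤ.* + y ℤ.+ + z
    pos-lin x y z = trans (ℤ.pos-+ (x * y) z) (cong (ℤ._+ + z) (ℤ.pos-* x y))
    expand : ∀ x y z w u v → (x ℤ.* z ℤ.+ u - (x ℤ.* w ℤ.+ v)) - (y ℤ.* z ℤ.+ u - (y ℤ.* w ℤ.+ v))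
                             ≡ (x - y) ℤ.* (z - w)
    expand = ℤ-Ring.solve-∀
    factor : (+ (a * α + R) - + (a * β + R′)) - (+ (a′ * α + R) - + (a′ * β + R′))
             ≡ (+ a - + a′) ℤ.* (+ α - + β)
    factor = trans (cong₂ _-_ (cong₂ _-_ (pos-lin a α R) (pos-lin a β R′)) (cong₂ _-_ (pos-lin a′ α R) (pos-lin a′ β R′)))
                   (expand (+ a) (+ a′) (+ α) (+ β) (+ R) (+ R′))

  module _ {p : ℕ} (p-prime : Prime p) where

    private instance
      p≢0 : NonZero p
      p≢0 = prime⇒nonZero p-prime

    euclidsLemmaℤ : ∀ {i j} → + p ∣ℤ i ℤ.* j → + p ∣ℤ i ⊎ + p ∣ℤ j
    euclidsLemmaℤ {i} {j} p∣ij with euclidsLemma ℤ.∣ i ∣ ℤ.∣ j ∣ p-prime (subst (p ∣_) (ℤ.abs-* i j) (∣⇒∣ᵤ p∣ij))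
    ... | inj₁ p∣i = inj₁ (∣ᵤ⇒∣ p∣i)
    ... | inj₂ p∣j = inj₂ (∣ᵤ⇒∣ p∣j)

    toℕ-injective-mod : (a b : Fin p) → toℕ a ≡ toℕ b mod p → a ≡ b
    toℕ-injective-mod a b a≡b = Fin.toℕ-injective (ℤ.+-injective (ℤ.i-j≡0⇒i≡j _ _ (ℤ.∣i∣≡0⇒i≡0 distance≡0)))
      where
      distance<p : ℤ.∣ + toℕ a - + toℕ b ∣ < p
      distance<p rewrite ℤ.m-n≡m⊖n (toℕ a) (toℕ b) =
        ≤-<-trans (ℤ.∣m⊝n∣≤m⊔n (toℕ a) (toℕ b)) (⊔-pres-<m (Fin.toℕ<n a) (Fin.toℕ<n b))
      distance≡0 : ℤ.∣ + toℕ a - + toℕ b ∣ ≡ 0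
      distance≡0 = trans (sym (m<n⇒m%n≡m distance<p)) (n∣m⇒m%n≡0 _ p (∣⇒∣ᵤ a≡b))

    ∃-root-of-shift : (A : ℕ) → ∃ λ (c : Fin p) → p ∣ toℕ c + A
    ∃-root-of-shift A = c , subst (λ r → p ∣ r + A) (sym (Fin.toℕ-fromℕ< r<p)) p∣r+A
      where
      r<p = n%ℕd<d (ℤ.- + A) p
      c : Fin p
      c = fromℕ< r<p
      r = (ℤ.- + A) %ℕ p
      q = (ℤ.- + A) /ℕ p
      r+A≡-q*p : + (r + A) ≡ ℤ.- q ℤ.* + p
      r+A≡-q*p = begin
        + (r + A)                            ≡⟨ ℤ.pos-+ r A ⟩
        + r ℤ.+ + A                          ≡⟨ cong (λ t → + r ℤ.+ t) (ℤ.neg-involutive (+ A)) ⟨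
        + r - (ℤ.- + A)                      ≡⟨ cong (λ t → + r - t) (a≡a%ℕn+[a/ℕn]*n (ℤ.- + A) p) ⟩
        + r - (+ r ℤ.+ q ℤ.* + p)            ≡⟨ cancel (+ r) q (+ p) ⟩
        ℤ.- q ℤ.* + p                        ∎
        where
        open ≡-Reasoning
        cancel : ∀ x y z → x - (x ℤ.+ y ℤ.* z) ≡ ℤ.- y ℤ.* z
        cancel = ℤ-Ring.solve-∀
      p∣r+A : p ∣ r + A
      p∣r+A = ∣⇒∣ᵤ (divides (ℤ.- q) r+A≡-q*p)

    linear-unique : ∀ {α β R R′} → ¬ α ≡ β mod p → (a a′ : Fin p) →
      toℕ a * α + R ≡ toℕ a * β + R′ mod p → toℕ a′ * α + R ≡ toℕ a′ * β + R′ mod p → a ≡ a′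
    linear-unique α≢β a a′ eq eq′ with euclidsLemmaℤ (≡-mod-difference-factor (toℕ a) (toℕ a′) eq eq′)
    ... | inj₁ p∣a-a′ = toℕ-injective-mod a a′ p∣a-a′
    ... | inj₂ p∣α-β  = ⊥-elim (α≢β p∣α-β)

    count-roots-of-shift : (A : ℕ) → ∑ (allFin p) (λ c → indicator (p ∣? toℕ c + A)) ≡ 1
    count-roots-of-shift A =
      exactlyOne⇒count≡1 (λ c → p ∣? toℕ c + A) (proj₁ (∃-root-of-shift A)) (proj₂ (∃-root-of-shift A))
        (λ {c} {c′} p∣c+A p∣c′+A → toℕ-injective-mod c c′ (+-cancelʳ-≡-mod (toℕ c) (toℕ c′) A (∣∧∣⇒≡-mod p∣c+A p∣c′+A)))

    count-common-roots-of-shifts : (A B : ℕ) →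
      ∑ (allFin p) (λ c → indicator (p ∣? toℕ c + A) * indicator (p ∣? toℕ c + B)) ≤ indicator (A ≡? B mod p)
    count-common-roots-of-shifts A B = begin
      ∑ (allFin p) (λ c → indicator (p ∣? toℕ c + A) * indicator (p ∣? toℕ c + B))
        ≤⟨ ∑-mono-≤ (allFin p) (λ c → indicator-*-mono (p ∣? toℕ c + A) (p ∣? toℕ c + B) (A ≡? B mod p)
                                   (λ p∣c+A p∣c+B → +-cancelˡ-≡-mod (toℕ c) A B (∣∧∣⇒≡-mod p∣c+A p∣c+B))) ⟩
      ∑ (allFin p) (λ c → indicator (p ∣? toℕ c + A) * indicator (A ≡? B mod p))
        ≡⟨ ∑-*ʳ (indicator (A ≡? B mod p)) (allFin p) _ ⟩
      ∑ (allFin p) (λ c → indicator (p ∣? toℕ c + A)) * indicator (A ≡? B mod p)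
        ≡⟨ cong (_* indicator (A ≡? B mod p)) (count-roots-of-shift A) ⟩
      1 * indicator (A ≡? B mod p)
        ≡⟨ *-identityˡ _ ⟩
      indicator (A ≡? B mod p) ∎
      where open ≤-Reasoning

    count-linear-roots : ∀ {α β} R R′ → ¬ α ≡ β mod p →
      ∑ (allFin p) (λ a → indicator (toℕ a * α + R ≡? toℕ a * β + R′ mod p)) ≤ 1
    count-linear-roots R R′ α≢β = atMostOne⇒count≤1 _ (λ {a} {a′} → linear-unique α≢β a a′)


    roots-of-linearForm : ∀ {m} (w : Fin (suc m) → ℕ) (k : Fin (suc m)) → w k ≡ 1 →
      ∑ (allPoints p (suc m)) (λ f → indicator (p ∣? linearForm w f)) ≡ p ^ m
    roots-of-linearForm {m} w k wk≡1 = begin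
      ∑ (allPoints p (suc m)) (λ f → indicator (p ∣? linearForm w f))
        ≡⟨ ∑-vecs-insertAt (allFin p) k _ ⟩
      ∑ (allFin p) (λ c → ∑ (allPoints p m) (λ v → indicator (p ∣? linearForm w (insertAt v k c))))
        ≡⟨ ∑-cong (allFin p) (λ c → ∑-cong (allPoints p m) (λ v → cong (λ t → indicator (p ∣? t)) (linearForm-insertAt-unit w k wk≡1 v c))) ⟩
      ∑ (allFin p) (λ c → ∑ (allPoints p m) (λ v → indicator (p ∣? toℕ c + ρ v)))
        ≡⟨ ∑-comm (allFin p) (allPoints p m) _ ⟩
      ∑ (allPoints p m) (λ v → ∑ (allFin p) (λ c → indicator (p ∣? toℕ c + ρ v)))
        ≡⟨ ∑-cong (allPoints p m) (λ v → count-roots-of-shift (ρ v)) ⟩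
      ∑ (allPoints p m) (λ _ → 1)
        ≡⟨ ∑-allPoints-1 p m ⟩
      p ^ m ∎
      where
      open ≡-Reasoning
      ρ = linearForm (w ∘ punchIn k)

    common-roots≤congruences : ∀ {m} (w w′ : Fin (suc m) → ℕ) (k : Fin (suc m)) → w k ≡ 1 → w′ k ≡ 1 →
      ∑ (allPoints p (suc m)) (λ f → indicator (p ∣? linearForm w f) * indicator (p ∣? linearForm w′ f))
        ≤ ∑ (allPoints p m) (λ v → indicator (linearForm (w ∘ punchIn k) v ≡? linearForm (w′ ∘ punchIn k) v mod p))
    common-roots≤congruences {m} w w′ k wk≡1 w′k≡1 = begin
      ∑ (allPoints p (suc m)) (λ f → indicator (p ∣? linearForm w f) * indicator (p ∣? linearForm w′ f))
        ≡⟨ ∑-vecs-insertAt (allFin p) k _ ⟩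
      ∑ (allFin p) (λ c → ∑ (allPoints p m) (λ v → indicator (p ∣? linearForm w (insertAt v k c)) * indicator (p ∣? linearForm w′ (insertAt v k c))))
        ≡⟨ ∑-cong (allFin p) (λ c → ∑-cong (allPoints p m) (λ v →
             cong₂ (λ s t → indicator (p ∣? s) * indicator (p ∣? t))
                   (linearForm-insertAt-unit w k wk≡1 v c) (linearForm-insertAt-unit w′ k w′k≡1 v c))) ⟩
      ∑ (allFin p) (λ c → ∑ (allPoints p m) (λ v → indicator (p ∣? toℕ c + ρ v) * indicator (p ∣? toℕ c + ρ′ v)))
        ≡⟨ ∑-comm (allFin p) (allPoints p m) _ ⟩
      ∑ (allPoints p m) (λ v → ∑ (allFin p) (λ c → indicator (p ∣? toℕ c + ρ v) * indicator (p ∣? toℕ c + ρ′ v)))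
        ≤⟨ ∑-mono-≤ (allPoints p m) (λ v → count-common-roots-of-shifts (ρ v) (ρ′ v)) ⟩
      ∑ (allPoints p m) (λ v → indicator (ρ v ≡? ρ′ v mod p)) ∎
      where
      open ≤-Reasoning
      ρ = linearForm (w ∘ punchIn k)
      ρ′ = linearForm (w′ ∘ punchIn k)

    count-congruences : ∀ {m} (w w′ : Fin (suc m) → ℕ) (k : Fin (suc m)) → ¬ w k ≡ w′ k mod p →
      ∑ (allPoints p (suc m)) (λ v → indicator (linearForm w v ≡? linearForm w′ v mod p)) ≤ p ^ m
    count-congruences {m} w w′ k wk≢w′k = begin
      ∑ (allPoints p (suc m)) (λ v → indicator (linearForm w v ≡? linearForm w′ v mod p))
        ≡⟨ ∑-vecs-insertAt (allFin p) k _ ⟩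
      ∑ (allFin p) (λ a → ∑ (allPoints p m) (λ u → indicator (linearForm w (insertAt u k a) ≡? linearForm w′ (insertAt u k a) mod p)))
        ≡⟨ ∑-cong (allFin p) (λ a → ∑-cong (allPoints p m) (λ u →
             cong₂ (λ s t → indicator (s ≡? t mod p)) (linearForm-insertAt w k u a) (linearForm-insertAt w′ k u a))) ⟩
      ∑ (allFin p) (λ a → ∑ (allPoints p m) (λ u → indicator (toℕ a * w k + ρ u ≡? toℕ a * w′ k + ρ′ u mod p)))
        ≡⟨ ∑-comm (allFin p) (allPoints p m) _ ⟩
      ∑ (allPoints p m) (λ u → ∑ (allFin p) (λ a → indicator (toℕ a * w k + ρ u ≡? toℕ a * w′ k + ρ′ u mod p)))
        ≤⟨ ∑-mono-≤ (allPoints p m) (λ u → count-linear-roots (ρ u) (ρ′ u) wk≢w′k) ⟩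
      ∑ (allPoints p m) (λ _ → 1)
        ≡⟨ ∑-allPoints-1 p m ⟩
      p ^ m ∎
      where
      open ≤-Reasoning
      ρ = linearForm (w ∘ punchIn k)
      ρ′ = linearForm (w′ ∘ punchIn k)

    common-roots-of-linearForms : ∀ {m} (w w′ : Fin (suc (suc m)) → ℕ) {k₀ k₁} → k₀ ≢ k₁ →
      w k₀ ≡ 1 → w′ k₀ ≡ 1 → ¬ w k₁ ≡ w′ k₁ mod p →
      ∑ (allPoints p (suc (suc m))) (λ f → indicator (p ∣? linearForm w f) * indicator (p ∣? linearForm w′ f)) ≤ p ^ m
    common-roots-of-linearForms w w′ {k₀} {k₁} k₀≢k₁ wk₀≡1 w′k₀≡1 wk₁≢w′k₁ =
      ≤-trans (common-roots≤congruences w w′ k₀ wk₀≡1 w′k₀≡1)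
              (count-congruences (w ∘ punchIn k₀) (w′ ∘ punchIn k₀) (punchOut k₀≢k₁)
                 (subst (λ k → ¬ w k ≡ w′ k mod p) (sym (Fin.punchIn-punchOut k₀≢k₁)) wk₁≢w′k₁))

    zeros : ∀ {D n} → (Vec (Fin p) D → Fin n → ℕ) → Vec (Fin p) n → ℕ
    zeros {D} W f = length (filter (λ x → p ∣? linearForm (W x) f) (allPoints p D))

    zeros≡∑ : ∀ {D n} (W : Vec (Fin p) D → Fin n → ℕ) (f : Vec (Fin p) n) →
      zeros W f ≡ ∑ (allPoints p D) (λ x → indicator (p ∣? linearForm (W x) f))
    zeros≡∑ {D} W f = length-filter≡∑ (λ x → p ∣? linearForm (W x) f) (allPoints p D)

    ∑-zeros : ∀ {D m} (W : Vec (Fin p) D → Fin (suc m) → ℕ) (k : Fin (suc m)) → (∀ x → W x k ≡ 1) →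
      ∑ (allPoints p (suc m)) (zeros W) ≡ p ^ D * p ^ m
    ∑-zeros {D} {m} W k Wk≡1 = begin
      ∑ (allPoints p (suc m)) (zeros W)
        ≡⟨ ∑-cong (allPoints p (suc m)) (zeros≡∑ W) ⟩
      ∑ (allPoints p (suc m)) (λ f → ∑ (allPoints p D) (λ x → indicator (p ∣? linearForm (W x) f)))
        ≡⟨ ∑-comm (allPoints p (suc m)) (allPoints p D) _ ⟩
      ∑ (allPoints p D) (λ x → ∑ (allPoints p (suc m)) (λ f → indicator (p ∣? linearForm (W x) f)))
        ≡⟨ ∑-cong (allPoints p D) (λ x → roots-of-linearForm (W x) k (Wk≡1 x)) ⟩
      ∑ (allPoints p D) (λ _ → p ^ m)
        ≡⟨ ∑-const (allPoints p D) (p ^ m) ⟩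
      length (allPoints p D) * p ^ m
        ≡⟨ cong (_* p ^ m) (length-allPoints p D) ⟩
      p ^ D * p ^ m ∎
      where open ≡-Reasoning

    ∑-zeros²-≤ : ∀ {D m} (W : Vec (Fin p) D → Fin (suc (suc m)) → ℕ) → HasAffineMonomials W →
      ∑ (allPoints p (suc (suc m))) (λ f → zeros W f * zeros W f) ≤ p ^ D * (p ^ D * p ^ m + p ^ suc m)
    ∑-zeros²-≤ {D} {m} W affine = begin
      ∑ F (λ f → zeros W f * zeros W f)
        ≡⟨ ∑-cong F (λ f → trans (cong₂ _*_ (zeros≡∑ W f) (zeros≡∑ W f)) (∑-square X (λ x → root x f))) ⟩
      ∑ F (λ f → ∑ X (λ x → ∑ X (λ y → root x f * root y f)))
        ≡⟨ ∑-comm F X _ ⟩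
      ∑ X (λ x → ∑ F (λ f → ∑ X (λ y → root x f * root y f)))
        ≡⟨ ∑-cong X (λ x → ∑-comm F X _) ⟩
      ∑ X (λ x → ∑ X (λ y → ∑ F (λ f → root x f * root y f)))
        ≤⟨ ∑-mono-≤ X (λ x → ∑-mono-≤ X (λ y → common-roots x y)) ⟩
      ∑ X (λ x → ∑ X (λ y → p ^ m + indicator (x ≟ᵥ y) * p ^ suc m))
        ≡⟨ ∑-cong X (λ x → trans (∑-distrib-+ X _ _) (cong₂ _+_ (∑-const X (p ^ m)) (diagonal x))) ⟩
      ∑ X (λ _ → length X * p ^ m + p ^ suc m)
        ≡⟨ ∑-const X _ ⟩
      length X * (length X * p ^ m + p ^ suc m)
        ≡⟨ cong (λ l → l * (l * p ^ m + p ^ suc m)) (length-allPoints p D) ⟩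
      p ^ D * (p ^ D * p ^ m + p ^ suc m) ∎
      where
      open ≤-Reasoning
      open HasAffineMonomials affine
      F = allPoints p (suc (suc m))
      X = allPoints p D
      root : Vec (Fin p) D → Vec (Fin p) (suc (suc m)) → ℕ
      root x f = indicator (p ∣? linearForm (W x) f)
      diagonal : ∀ x → ∑ X (λ y → indicator (x ≟ᵥ y) * p ^ suc m) ≡ p ^ suc m
      diagonal x = trans (∑-*ʳ (p ^ suc m) X _) (trans (cong (_* p ^ suc m) (∑-allPoints-≟ x)) (*-identityˡ _))
      common-roots : ∀ x y → ∑ F (λ f → root x f * root y f) ≤ p ^ m + indicator (x ≟ᵥ y) * p ^ suc m
      common-roots x y with x ≟ᵥ y
      ... | yes refl = begin
        ∑ F (λ f → root x f * root x f)   ≡⟨ ∑-cong F (λ f → indicator-idem (p ∣? linearForm (W x) f)) ⟩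
        ∑ F (root x)                      ≡⟨ roots-of-linearForm (W x) one (W-one x) ⟩
        p ^ suc m                         ≤⟨ m≤n+m _ (p ^ m) ⟩
        p ^ m + p ^ suc m                 ≡⟨ cong (λ t → p ^ m + t) (*-identityˡ _) ⟨
        p ^ m + 1 * p ^ suc m             ∎
      ... | no x≢y = let j , xⱼ≢yⱼ = ≢⇒∃-lookup-≢ x≢y in begin
        ∑ F (λ f → root x f * root y f)
          ≤⟨ common-roots-of-linearForms (W x) (W y) (one≢coordinate j) (W-one x) (W-one y)
               (subst₂ (λ a b → ¬ a ≡ b mod p) (sym (W-coordinate x j)) (sym (W-coordinate y j))
                       (xⱼ≢yⱼ ∘ toℕ-injective-mod _ _)) ⟩
        p ^ m                             ≡⟨ +-identityʳ (p ^ m) ⟨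
        p ^ m + 0                         ∎

    affine-three-quarters : ∀ {D n} (W : Vec (Fin p) (suc D) → Fin n → ℕ) → HasAffineMonomials W → 16 ≤ p ^ D →
      3 * length (allPoints p n) ≤ 4 * length (filter (λ f → p ^ D ≤? 2 * zeros W f) (allPoints p n))
    affine-three-quarters {n = zero} W affine _ = ⊥-elim (Fin.¬Fin0 (HasAffineMonomials.one affine))
    affine-three-quarters {n = suc zero} W affine _
      with HasAffineMonomials.one affine | HasAffineMonomials.coordinate affine zero
         | HasAffineMonomials.one≢coordinate affine zero
    ... | zero | zero | one≢coordinate₀ = ⊥-elim (one≢coordinate₀ refl)
    affine-three-quarters {D} {suc (suc m)} W affine 16≤pᴰ =
      chebyshev-three-quarters F (zeros W) (p ^ D) 16≤pᴰ mean second-moment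
      where
      open HasAffineMonomials affine
      F = allPoints p (suc (suc m))
      mean : ∑ F (zeros W) ≡ length F * p ^ D
      mean = begin
        ∑ F (zeros W)                   ≡⟨ ∑-zeros W one W-one ⟩
        p * p ^ D * (p * p ^ m)         ≡⟨ exponents p (p ^ D) (p ^ m) ⟩
        p * (p * p ^ m) * p ^ D         ≡⟨ cong (_* p ^ D) (length-allPoints p (suc (suc m))) ⟨
        length F * p ^ D                ∎
        where
        open ≡-Reasoning
        exponents : ∀ p a b → p * a * (p * b) ≡ p * (p * b) * a
        exponents = ℕ-Ring.solve-∀
      second-moment : ∑ F (λ f → zeros W f * zeros W f) ≤ length F * (p ^ D * p ^ D + p ^ D)
      second-moment = begin
        ∑ F (λ f → zeros W f * zeros W f)               ≤⟨ ∑-zeros²-≤ W affine ⟩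
        p * p ^ D * (p * p ^ D * p ^ m + p * p ^ m)      ≡⟨ exponents p (p ^ D) (p ^ m) ⟩
        p * (p * p ^ m) * (p ^ D * p ^ D + p ^ D)        ≡⟨ cong (_* (p ^ D * p ^ D + p ^ D)) (length-allPoints p (suc (suc m))) ⟨
        length F * (p ^ D * p ^ D + p ^ D)               ∎
        where
        open ≤-Reasoning
        exponents : ∀ p a b → p * a * (p * a * b + p * b) ≡ p * (p * b) * (a * a + a)
        exponents = ℕ-Ring.solve-∀

zeroExponent : (D : ℕ) → Vec ℕ D
zeroExponent D = replicate D 0

unitExponent : {D : ℕ} → Fin D → Vec ℕ D
unitExponent {suc D} zero    = 1 ∷ zeroExponent D
unitExponent {suc D} (suc j) = 0 ∷ unitExponent j

monVal-zeroExponent : (D : ℕ) (x : Vec (Fin p) D) → monVal (zeroExponent D) x ≡ 1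
monVal-zeroExponent zero    []      = refl
monVal-zeroExponent (suc D) (a ∷ x) = trans (+-identityʳ _) (monVal-zeroExponent D x)

monVal-unitExponent : {D : ℕ} (j : Fin D) (x : Vec (Fin p) D) → monVal (unitExponent j) x ≡ toℕ (lookup x j)
monVal-unitExponent {D = suc D} zero    (a ∷ x) =
  trans (cong (toℕ a * 1 *_) (monVal-zeroExponent D x)) (trans (*-identityʳ _) (*-identityʳ _))
monVal-unitExponent {D = suc D} (suc j) (a ∷ x) = trans (+-identityʳ _) (monVal-unitExponent j x)

zeroExponent≢unitExponent : {D : ℕ} (j : Fin D) → zeroExponent D ≢ unitExponent j
zeroExponent≢unitExponent {suc D} zero    ()
zeroExponent≢unitExponent {suc D} (suc j) eq = zeroExponent≢unitExponent j (Vec.∷-injectiveʳ eq)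

∈-vecs : {xs : List A} (v : Vec A n) → (∀ i → lookup v i ∈ xs) → v ∈ vecs n xs
∈-vecs         []      entries = here refl
∈-vecs {xs = xs} (a ∷ v) entries =
  ∈-concat⁺′ (∈-map⁺ (a ∷_) (∈-vecs v (entries ∘ suc))) (∈-map⁺ (λ c → map (c ∷_) (vecs _ xs)) (entries zero))

lookup≤sum : {D : ℕ} (e : Vec ℕ D) (i : Fin D) → lookup e i ≤ Data.Vec.sum e
lookup≤sum (a ∷ e) zero    = m≤m+n a _
lookup≤sum (a ∷ e) (suc i) = ≤-trans (lookup≤sum e i) (m≤n+m _ a)

∈-monomials : {D Δ : ℕ} (e : Vec ℕ D) → Data.Vec.sum e ≤ Δ → e ∈ monomials D Δ
∈-monomials e degree≤Δ =
  ∈-filter⁺ (λ e → Data.Vec.sum e ≤? _) (∈-vecs e (λ i → ∈-upTo⁺ (s≤s (≤-trans (lookup≤sum e i) degree≤Δ)))) degree≤Δ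

sum-zeroExponent : (D : ℕ) → Data.Vec.sum (zeroExponent D) ≡ 0
sum-zeroExponent zero    = refl
sum-zeroExponent (suc D) = sum-zeroExponent D

sum-unitExponent : {D : ℕ} (j : Fin D) → Data.Vec.sum (unitExponent j) ≡ 1
sum-unitExponent {suc D} zero    = cong suc (sum-zeroExponent D)
sum-unitExponent {suc D} (suc j) = sum-unitExponent j

-- evalℕ p D Δ f x unfolds to linearForm (monomialValues p D Δ x) f.
monomialValues : (p D Δ : ℕ) → Vec (Fin p) D → Fin (nMon D Δ) → ℕ
monomialValues p D Δ x i = monVal (Data.List.lookup (monomials D Δ) i) x

monomialValues-affine : (p D Δ : ℕ) → 1 ≤ Δ → HasAffineMonomials (monomialValues p D Δ)
monomialValues-affine p D Δ 1≤Δ = record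
  { one            = index zero∈
  ; coordinate     = λ j → index (unit∈ j)
  ; W-one          = λ x → trans (cong (λ e → monVal e x) (sym (lookup-index zero∈))) (monVal-zeroExponent D x)
  ; W-coordinate   = λ x j → trans (cong (λ e → monVal e x) (sym (lookup-index (unit∈ j)))) (monVal-unitExponent j x)
  ; one≢coordinate = λ j same-index → zeroExponent≢unitExponent j (begin
      zeroExponent D                                    ≡⟨ lookup-index zero∈ ⟩
      Data.List.lookup (monomials D Δ) (index zero∈)     ≡⟨ cong (Data.List.lookup (monomials D Δ)) same-index ⟩
      Data.List.lookup (monomials D Δ) (index (unit∈ j)) ≡⟨ lookup-index (unit∈ j) ⟨
      unitExponent j                                    ∎)
  }
  where
  open ≡-Reasoning
  zero∈ : zeroExponent D ∈ monomials D Δ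
  zero∈ = ∈-monomials (zeroExponent D) (subst (_≤ Δ) (sym (sum-zeroExponent D)) z≤n)
  unit∈ : (j : Fin D) → unitExponent j ∈ monomials D Δ
  unit∈ j = ∈-monomials (unitExponent j) (subst (_≤ Δ) (sym (sum-unitExponent j)) 1≤Δ)

lemma4p2 : (Δ D p : ℕ) → 3 ≤ Δ → 3 ≤ D → Prime p → 4 ≤ p →
    3 * length (allPolys p D Δ) ≤ 4 * nGood p D Δ
lemma4p2 Δ (suc (suc (suc d))) p (s≤s _) (s≤s (s≤s (s≤s _))) p-prime 4≤p =
  affine-three-quarters p-prime (monomialValues p D Δ) (monomialValues-affine p D Δ (s≤s z≤n)) 16≤p²⁺ᵈ
  where
  D = 3 + d
  16≤p²⁺ᵈ : 16 ≤ p ^ (2 + d)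
  16≤p²⁺ᵈ = *-mono-≤ 4≤p (*-mono-≤ 4≤p (m^n>0 p {{prime⇒nonZero p-prime}} d))
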